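{- Let $f\colon\{2,4,6\}\to\mathbb{N}$ be any function such that, for infinitely many $n$, there exists an extended $f$-code $F\colon\binom{[2n]}{n}\to\{0,1\}^{m(n)}$. Then for any fixed constant $k$ there is a constant $r\le f(2)\cdot k$ such that, for infinitely many values $n$, there exists an extended $f$-code $E\colon\binom{[n]}{k}\to\binom{[m'(n)]}{r}$.
   Context: $\binom{[n]}{k}$ denotes the set of strings in $\{0,1\}^n$ of Hamming weight exactly $k$ (identified with $k$-subsets of $[n]$), and $\mathrm{dist}$ is Hamming distance. For a partial function $f$ with domain $\mathrm{dom}(f)\subseteq\mathbb{N}$ and a set $\mathcal{X}$ of binary strings of equal length, $E\colon\mathcal{X}\to\{0,1\}^m$ is an $f$-code if $\mathrm{dist}(E(x),E(y))=f(\mathrm{dist}(x,y))$ whenever $x,y\in\mathcal{X}$ and $\mathrm{dist}(x,y)\in\mathrm{dom}(f)$. $E$ is an extended $f$-code if there is a total function $g\colon\mathbb{N}\to\mathbb{N}$ agreeing with $f$ on $\mathrm{dom}(f)$ such that $\mathrm{dist}(E(x),E(y))=g(\mathrm{dist}(x,y))$ for all $x,y\in\mathcal{X}$ ($g$ may depend on the code). $m(n),m'(n)$ are some functions of $n$. -}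

module Defs where

open import Data.Nat using (ℕ; zero; suc; _+_; _≤_)
open import Data.Bool using (Bool; true; false; if_then_else_)
open import Data.Vec using (Vec; []; _∷_)
open import Data.Product using (Σ; ∃; _×_; proj₁)
open import Data.Sum using (_⊎_)
open import Relation.Binary.PropositionalEquality using (_≡_)

weight : ∀ {n} → Vec Bool n → ℕ
weight []           = 0
weight (true  ∷ xs) = suc (weight xs)
weight (false ∷ xs) = weight xs

dist : ∀ {n} → Vec Bool n → Vec Bool n → ℕ
dist []       []       = 0
dist (x ∷ xs) (y ∷ ys) = (if x Data.Bool.xor y then 1 else 0) + dist xs ys

-- ([n] choose k): binary strings of length n of Hamming weight exactly k
Slice : ℕ → ℕ → Set
Slice n k = Σ (Vec Bool n) (λ x → weight x ≡ k)

Dom246 : ℕ → Set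
Dom246 d = d ≡ 2 ⊎ (d ≡ 4 ⊎ d ≡ 6)

-- E : ([n] choose k) → {0,1}^m is an extended f-code for a partial function
-- f with domain D (f given by its values on D; values off D are irrelevant):
-- some total g agreeing with f on D satisfies
-- dist (E x) (E y) = g (dist x y) for all x, y.
ExtendedCode : (D : ℕ → Set) (f : ℕ → ℕ) {n k m : ℕ} → (Slice n k → Vec Bool m) → Set
ExtendedCode D f {n} {k} E =
  Σ (ℕ → ℕ) λ g → (∀ d → D d → g d ≡ f d) ×
    (∀ (x y : Slice n k) → dist (E x) (E y) ≡ g (dist (proj₁ x) (proj₁ y)))

InfinitelyMany : (ℕ → Set) → Set
InfinitelyMany P = ∀ N → ∃ λ n → N ≤ n × P n

{-# OPTIONS --safe #-}
-- Let b = 0ⁿ1ⁿ and embed ([n] choose k) isometrically into ([2n] choose n) by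
-- x ↦ x 0ᵏ1ⁿ⁻ᵏ. Every embedded word is at distance 2k from b, so an extended
-- f-code F (with total extension g) maps it to distance g(2k) from F(b).
-- XOR-ing with F(b) therefore gives codewords of constant weight g(2k), and
-- padding with ones raises the weight to r = f(2)·k. That padding exists
-- because g(2k) ≤ f(2)·k: b is joined to the embedded 1ᵏ0ⁿ⁻ᵏ by k steps of
-- distance 2, each of which F maps to distance f(2).
module Submission where

open import Defs
open import Data.Nat using (ℕ; zero; suc; _+_; _*_; _∸_; _≤_; _<_; z≤n; s≤s)
open import Data.Nat.Properties
open import Algebra.Properties.CommutativeSemigroup +-commutativeSemigroup using (interchange)
open import Data.Bool using (Bool; true; false; _xor_; if_then_else_)
open import Data.Vec using (Vec; []; _∷_; _++_; zipWith)
open import Data.Product using (Σ; _×_; _,_; proj₁)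
open import Data.Sum using (inj₁)
open import Function using (_∘_)
open import Relation.Binary.PropositionalEquality

bitDist : Bool → Bool → ℕ
bitDist a b = if a xor b then 1 else 0

bitDist-triangle : ∀ a b c → bitDist a c ≤ bitDist a b + bitDist b c
bitDist-triangle true  true  true  = z≤n
bitDist-triangle true  true  false = s≤s z≤n
bitDist-triangle true  false true  = z≤n
bitDist-triangle true  false false = s≤s z≤n
bitDist-triangle false true  true  = s≤s z≤n
bitDist-triangle false true  false = z≤n
bitDist-triangle false false true  = s≤s z≤n
bitDist-triangle false false false = z≤n

bitDist-xorʳ : ∀ a b c → bitDist (a xor c) (b xor c) ≡ bitDist a b
bitDist-xorʳ true  true  true  = refl
bitDist-xorʳ true  true  false = refl
bitDist-xorʳ true  false true  = refl
bitDist-xorʳ true  false false = refl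
bitDist-xorʳ false true  true  = refl
bitDist-xorʳ false true  false = refl
bitDist-xorʳ false false true  = refl
bitDist-xorʳ false false false = refl

dist-self : ∀ {n} (x : Vec Bool n) → dist x x ≡ 0
dist-self []          = refl
dist-self (true  ∷ x) = dist-self x
dist-self (false ∷ x) = dist-self x

dist-triangle : ∀ {n} (x y z : Vec Bool n) → dist x z ≤ dist x y + dist y z
dist-triangle []      []      []      = z≤n
dist-triangle (a ∷ x) (b ∷ y) (c ∷ z) =
  ≤-trans (+-mono-≤ (bitDist-triangle a b c) (dist-triangle x y z))
          (≤-reflexive (interchange (bitDist a b) (bitDist b c) (dist x y) (dist y z)))

dist-++ : ∀ {m n} (x y : Vec Bool m) (u v : Vec Bool n) →
          dist (x ++ u) (y ++ v) ≡ dist x y + dist u v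
dist-++ []      []      u v = refl
dist-++ (a ∷ x) (b ∷ y) u v =
  trans (cong (bitDist a b +_) (dist-++ x y u v)) (sym (+-assoc (bitDist a b) _ _))

dist-xorʳ : ∀ {n} (x y z : Vec Bool n) →
            dist (zipWith _xor_ x z) (zipWith _xor_ y z) ≡ dist x y
dist-xorʳ []      []      []      = refl
dist-xorʳ (a ∷ x) (b ∷ y) (c ∷ z) = cong₂ _+_ (bitDist-xorʳ a b c) (dist-xorʳ x y z)

weight-++ : ∀ {m n} (x : Vec Bool m) (u : Vec Bool n) → weight (x ++ u) ≡ weight x + weight u
weight-++ []          u = refl
weight-++ (true  ∷ x) u = cong suc (weight-++ x u)
weight-++ (false ∷ x) u = weight-++ x u

weight-xor : ∀ {n} (x y : Vec Bool n) → weight (zipWith _xor_ x y) ≡ dist x y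
weight-xor []          []          = refl
weight-xor (true  ∷ x) (true  ∷ y) = weight-xor x y
weight-xor (true  ∷ x) (false ∷ y) = cong suc (weight-xor x y)
weight-xor (false ∷ x) (true  ∷ y) = cong suc (weight-xor x y)
weight-xor (false ∷ x) (false ∷ y) = weight-xor x y

dist-chain : ∀ {M} (h : ℕ → Vec Bool M) {c} j →
             (∀ i → i < j → dist (h (suc i)) (h i) ≤ c) → dist (h j) (h 0) ≤ j * c
dist-chain h zero    _    = ≤-reflexive (dist-self (h 0))
dist-chain h (suc j) step =
  ≤-trans (dist-triangle (h (suc j)) (h j) (h 0))
          (+-mono-≤ (step j (n<1+n j)) (dist-chain h j (λ i i<j → step i (m<n⇒m<1+n i<j))))

ExtendedCode-reindex :
  ∀ {D f n k N w M M′} (φ : Slice n k → Slice N w)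
    (F : Slice N w → Vec Bool M) (E : Slice n k → Vec Bool M′) →
  (∀ x y → dist (proj₁ (φ x)) (proj₁ (φ y)) ≡ dist (proj₁ x) (proj₁ y)) →
  (∀ x y → dist (E x) (E y) ≡ dist (F (φ x)) (F (φ y))) →
  ExtendedCode D f F → ExtendedCode D f E
ExtendedCode-reindex φ F E φ-isometric E≗F∘φ (g , g≗f , F-dist) =
  g , g≗f , λ x y → trans (E≗F∘φ x y) (trans (F-dist (φ x) (φ y)) (cong g (φ-isometric x y)))

leading : (n j : ℕ) → Vec Bool n
leading zero    j       = []
leading (suc n) zero    = false ∷ leading n zero
leading (suc n) (suc j) = true ∷ leading n j

weight-leading : ∀ {n j} → j ≤ n → weight (leading n j) ≡ j
weight-leading {zero}  z≤n       = refl
weight-leading {suc n} z≤n       = weight-leading {n} z≤n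
weight-leading {suc n} (s≤s j≤n) = cong suc (weight-leading j≤n)

dist-leading-zero : ∀ {n} (x : Vec Bool n) → dist x (leading n 0) ≡ weight x
dist-leading-zero []          = refl
dist-leading-zero (true  ∷ x) = cong suc (dist-leading-zero x)
dist-leading-zero (false ∷ x) = dist-leading-zero x

dist-leading-suc : ∀ {n j} → j < n → dist (leading n (suc j)) (leading n j) ≡ 1
dist-leading-suc {suc n} {zero}  _         = cong suc (dist-self (leading n 0))
dist-leading-suc {suc n} {suc j} (s≤s j<n) = dist-leading-suc j<n

module _ {X : Set} {M : ℕ} (E : X → Vec Bool M) (c : Vec Bool M) {D : ℕ} (r : ℕ)
         (D≤r : D ≤ r) (equidistant : ∀ x → dist (E x) c ≡ D) where

  constantWeight : X → Slice (M + r) r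
  constantWeight x = zipWith _xor_ (E x) c ++ leading r (r ∸ D) , (begin
    weight (zipWith _xor_ (E x) c ++ leading r (r ∸ D))
      ≡⟨ weight-++ (zipWith _xor_ (E x) c) (leading r (r ∸ D)) ⟩
    weight (zipWith _xor_ (E x) c) + weight (leading r (r ∸ D))
      ≡⟨ cong₂ _+_ (trans (weight-xor (E x) c) (equidistant x)) (weight-leading (m∸n≤m r D)) ⟩
    D + (r ∸ D)
      ≡⟨ m+[n∸m]≡n D≤r ⟩
    r ∎)
    where open ≡-Reasoning

  dist-constantWeight : ∀ x y →
    dist (proj₁ (constantWeight x)) (proj₁ (constantWeight y)) ≡ dist (E x) (E y)
  dist-constantWeight x y = begin
    dist (proj₁ (constantWeight x)) (proj₁ (constantWeight y))
      ≡⟨ dist-++ (zipWith _xor_ (E x) c) (zipWith _xor_ (E y) c) padding padding ⟩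
    dist (zipWith _xor_ (E x) c) (zipWith _xor_ (E y) c) + dist padding padding
      ≡⟨ cong₂ _+_ (dist-xorʳ (E x) (E y) c) (dist-self padding) ⟩
    dist (E x) (E y) + 0
      ≡⟨ +-identityʳ _ ⟩
    dist (E x) (E y) ∎
    where
    open ≡-Reasoning
    padding = leading r (r ∸ D)

-- trailing n j = 0ʲ1ⁿ⁻ʲ; its length is n + 0 so that words
-- u ++ trailing n j with u of length n inhabit Vec Bool (2 * n).
trailing : (n j : ℕ) → Vec Bool (n + 0)
trailing zero    j       = []
trailing (suc n) zero    = true ∷ trailing n zero
trailing (suc n) (suc j) = false ∷ trailing n j

weight-leading+trailing : ∀ n j → weight (leading n j) + weight (trailing n j) ≡ n
weight-leading+trailing zero    j       = refl
weight-leading+trailing (suc n) zero    =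
  trans (+-suc (weight (leading n 0)) _) (cong suc (weight-leading+trailing n zero))
weight-leading+trailing (suc n) (suc j) = cong suc (weight-leading+trailing n j)

dist-trailing-zero : ∀ {n j} → j ≤ n → dist (trailing n j) (trailing n 0) ≡ j
dist-trailing-zero {zero}  z≤n       = refl
dist-trailing-zero {suc n} z≤n       = dist-self (trailing n 0)
dist-trailing-zero {suc n} (s≤s j≤n) = cong suc (dist-trailing-zero j≤n)

dist-trailing-suc : ∀ {n j} → j < n → dist (trailing n (suc j)) (trailing n j) ≡ 1
dist-trailing-suc {suc n} {zero}  _         = cong suc (dist-self (trailing n 0))
dist-trailing-suc {suc n} {suc j} (s≤s j<n) = dist-trailing-suc j<n

pathPoint : (n j : ℕ) → Slice (2 * n) n
pathPoint n j = leading n j ++ trailing n j ,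
  trans (weight-++ (leading n j) (trailing n j)) (weight-leading+trailing n j)

dist-pathPoint-suc : ∀ {n j} → j < n →
  dist (proj₁ (pathPoint n (suc j))) (proj₁ (pathPoint n j)) ≡ 2
dist-pathPoint-suc {n} {j} j<n =
  trans (dist-++ (leading n (suc j)) (leading n j) (trailing n (suc j)) (trailing n j))
        (cong₂ _+_ (dist-leading-suc j<n) (dist-trailing-suc j<n))

module _ {n k : ℕ} (k≤n : k ≤ n) where

  embed : Slice n k → Slice (2 * n) n
  embed (x , wx) = x ++ trailing n k , (begin
    weight (x ++ trailing n k)                    ≡⟨ weight-++ x (trailing n k) ⟩
    weight x + weight (trailing n k)              ≡⟨ cong (_+ _) (trans wx (sym (weight-leading k≤n))) ⟩
    weight (leading n k) + weight (trailing n k)  ≡⟨ weight-leading+trailing n k ⟩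
    n                                             ∎)
    where open ≡-Reasoning

  dist-embed : ∀ x y → dist (proj₁ (embed x)) (proj₁ (embed y)) ≡ dist (proj₁ x) (proj₁ y)
  dist-embed (x , _) (y , _) =
    trans (dist-++ x y (trailing n k) (trailing n k))
          (trans (cong (dist x y +_) (dist-self (trailing n k))) (+-identityʳ _))

  dist-embed-pathPoint-zero : ∀ x → dist (proj₁ (embed x)) (proj₁ (pathPoint n 0)) ≡ k + k
  dist-embed-pathPoint-zero (x , wx) =
    trans (dist-++ x (leading n 0) (trailing n k) (trailing n 0))
          (cong₂ _+_ (trans (dist-leading-zero x) wx) (dist-trailing-zero k≤n))

constantWeightCode :
  ∀ {D f n k M} → D 2 → k ≤ n → (F : Slice (2 * n) n → Vec Bool M) → ExtendedCode D f F →
  Σ (Slice n k → Slice (M + f 2 * k) (f 2 * k)) λ E → ExtendedCode D f (proj₁ ∘ E)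
constantWeightCode {f = f} {n} {k} {M} 2∈D k≤n F F-code@(g , g≗f , F-dist) =
  E , ExtendedCode-reindex (embed k≤n) F (proj₁ ∘ E) (dist-embed k≤n) dist-E F-code
  where
  center : Vec Bool M
  center = F (pathPoint n 0)

  equidistant : ∀ x → dist (F (embed k≤n x)) center ≡ g (k + k)
  equidistant x = trans (F-dist _ _) (cong g (dist-embed-pathPoint-zero k≤n x))

  step : ∀ i → i < k → dist (F (pathPoint n (suc i))) (F (pathPoint n i)) ≤ f 2
  step i i<k = ≤-reflexive (trans (F-dist _ _)
    (trans (cong g (dist-pathPoint-suc (<-≤-trans i<k k≤n))) (g≗f 2 2∈D)))

  radius≤ : g (k + k) ≤ f 2 * k
  radius≤ = begin
    g (k + k)
      ≡⟨ cong g (dist-embed-pathPoint-zero k≤n (leading n k , weight-leading k≤n)) ⟨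
    g (dist (proj₁ (pathPoint n k)) (proj₁ (pathPoint n 0)))
      ≡⟨ F-dist (pathPoint n k) (pathPoint n 0) ⟨
    dist (F (pathPoint n k)) center
      ≤⟨ dist-chain (F ∘ pathPoint n) k step ⟩
    k * f 2
      ≡⟨ *-comm k (f 2) ⟩
    f 2 * k ∎
    where open ≤-Reasoning

  E : Slice n k → Slice (M + f 2 * k) (f 2 * k)
  E = constantWeight (F ∘ embed k≤n) center (f 2 * k) radius≤ equidistant

  dist-E : ∀ x y → dist (proj₁ (E x)) (proj₁ (E y)) ≡ dist (F (embed k≤n x)) (F (embed k≤n y))
  dist-E = dist-constantWeight (F ∘ embed k≤n) center (f 2 * k) radius≤ equidistant

proposition3p3 : (f : ℕ → ℕ) (m : ℕ → ℕ) →
    InfinitelyMany (λ n → Σ (Slice (2 * n) n → Vec Bool (m n)) λ F → ExtendedCode Dom246 f F) →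
    (k : ℕ) → Σ ℕ λ r → r ≤ f 2 * k × Σ (ℕ → ℕ) λ m′ →
      InfinitelyMany (λ n → Σ (Slice n k → Slice (m′ n) r) λ E → ExtendedCode Dom246 f (proj₁ ∘ E))
proposition3p3 f m codes k = f 2 * k , ≤-refl , (λ n → m n + f 2 * k) , λ N →
  let (n , N+k≤n , F , F-code) = codes (N + k)
  in n , ≤-trans (m≤m+n N k) N+k≤n ,
     constantWeightCode (inj₁ refl) (≤-trans (m≤n+m k N) N+k≤n) F F-code
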